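{- Let $a,b$ be sequences in a field $F$ of characteristic zero and $m\ge0$, and suppose $(a*b)_m=0$. Then for every $n\in\mathbb{Z}$, $(B^na*B^{ -n}b)_m=0$. In particular, if $a_{k,n}$ denote the entries of the binomial array of $a$ and $a_{k,n}=0$ for some $k\ge0$, $n\in\mathbb{Z}$, then $\sum_{i=0}^k\binom{l}{i}a_{k-i,n-l}=0$ for all $l\in\mathbb{Z}$.
   Context: For a sequence $a=(a_i)_{i\ge0}$ with generating function $p(x)$, the binomial array entries are $a_{k,n}=$ coefficient of $x^k$ in $(1+x)^np(x)$ ($k\ge0$, $n\in\mathbb{Z}$; inverse power series for $n<0$), and the binomial transform is $B^na_k=a_{k,n}$. The Cauchy product is $(a*b)_m=\sum_{i=0}^ma_ib_{m-i}$. Binomial coefficients for integer $n$ and $k\ge0$: $\binom{n}{k}=\frac{n!}{k!(n-k)!}$ if $0\le k\le n$, $\binom{n}{k}=(-1)^k\binom{ -n+k-1}{k}$ if $n<0$, and $0$ otherwise. -}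

module Defs where

open import Level using (Level; _⊔_) renaming (suc to lsuc)
open import Data.Nat using (ℕ; zero; suc; _∸_)
open import Data.Nat.Combinatorics using (_C_)
open import Data.Integer using (ℤ; +_; -[1+_])
open import Data.Product using (Σ)
open import Relation.Nullary using (¬_)
open import Algebra.Bundles using (CommutativeRing)

record Field (c ℓ : Level) : Set (lsuc (c ⊔ ℓ)) where
  field
    commutativeRing : CommutativeRing c ℓ
  open CommutativeRing commutativeRing public
  field
    1≉0     : ¬ (1# ≈ 0#)
    inverse : ∀ x → ¬ (x ≈ 0#) → Σ Carrier (λ y → (x * y) ≈ 1#)

module _ {c ℓ : Level} (F : Field c ℓ) where
  open Field F

  natF : ℕ → Carrier
  natF zero    = 0#
  natF (suc n) = 1# + natF n

  CharZero : Set ℓ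
  CharZero = ∀ n → ¬ (natF (suc n) ≈ 0#)

  intF : ℤ → Carrier
  intF (+ n)     = natF n
  intF -[1+ n ]  = - natF (suc n)

  sumTo : (ℕ → Carrier) → ℕ → Carrier
  sumTo f zero    = f 0
  sumTo f (suc m) = sumTo f m + f (suc m)

  cauchy : (ℕ → Carrier) → (ℕ → Carrier) → ℕ → Carrier
  cauchy a b m = sumTo (λ i → a i * b (m ∸ i)) m

-- integer binomial coefficient  binom n k  (n ∈ ℤ, k ≥ 0):
--   n ≥ 0 : n C k (which is 0 for k > n);
--   n = -(j+1) < 0 : (-1)^k * ((-n+k-1) C k) = (-1)^k * ((j+k) C k)
signℤ : ℕ → ℤ → ℤ
signℤ zero    z = z
signℤ (suc k) z = Data.Integer.- (signℤ k z)

binom : ℤ → ℕ → ℤ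
binom (+ n)     k = + (n C k)
binom -[1+ j ]  k = signℤ k (+ ((j Data.Nat.+ k) C k))

module _ {c ℓ : Level} (F : Field c ℓ) where
  open Field F

  -- binomial array entry a_{k,n} = [x^k] (1+x)^n p(x) = Σ_{i=0}^k binom n i · a_{k-i}
  binArray : (ℕ → Carrier) → ℕ → ℤ → Carrier
  binArray a k n = sumTo F (λ i → intF F (binom n i) * a (k ∸ i)) k

  B : ℤ → (ℕ → Carrier) → (ℕ → Carrier)
  B n a k = binArray a k n

-- The array of a sequence is its orbit under the binomial transform: writing p for its generating
-- function, B^s multiplies p by (1+x)^s.  The coefficients of (1+x)^s obey Pascal's rule for every
-- integer s, which forces B^s B^t = B^(s+t) (a solution of Pascal's rule on ℤ × ℕ is determined by
-- its row s = 0 and its column k = 0), and B^s commutes with the Cauchy product.  Hence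
-- B^n a * B^-n b = B^0 (a * b) = a * b, and Σ_i binom(l, i) a_{k-i, n-l} = (B^l B^(n-l) a)_k = a_{k,n}.
module Submission where

open import Defs
open import Level using (Level)
open import Data.Nat using (ℕ; zero; suc; _∸_; _≤_; z≤n)
open import Data.Integer using (ℤ; +_; -[1+_]; _⊖_)
open import Data.Product using (_×_; _,_)

import Data.Nat as ℕ
import Data.Nat.Properties as ℕ
import Data.Integer as ℤ
import Data.Integer.Properties as ℤ
open import Data.Nat.Combinatorics using (_C_; nCn≡1; nCk+nC[k+1]≡[n+1]C[k+1])
open import Data.Integer.Tactic.RingSolver using (solve-∀)
open import Relation.Binary.PropositionalEquality as ≡ using (_≡_)
open import Relation.Binary.Structures using (IsEquivalence)
open import Algebra.Bundles using (CommutativeSemigroup)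

ℤ-induction : ∀ {p} (P : ℤ → Set p) → P (+ 0) →
              (∀ s → P s → P (ℤ.suc s)) → (∀ s → P (ℤ.suc s) → P s) → ∀ s → P s
ℤ-induction P P0 up down (+ zero)      = P0
ℤ-induction P P0 up down (+ suc n)     = up (+ n) (ℤ-induction P P0 up down (+ n))
ℤ-induction P P0 up down -[1+ zero ]   = down -[1+ 0 ] P0
ℤ-induction P P0 up down -[1+ suc n ]  = down -[1+ suc n ] (ℤ-induction P P0 up down -[1+ n ])

signℤ-+ : ∀ k x y → signℤ k (x ℤ.+ y) ≡ signℤ k x ℤ.+ signℤ k y
signℤ-+ zero    x y = ≡.refl
signℤ-+ (suc k) x y =
  ≡.trans (≡.cong ℤ.-_ (signℤ-+ k x y)) (ℤ.neg-distrib-+ (signℤ k x) (signℤ k y))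

binom-zero : ∀ s → binom s 0 ≡ + 1
binom-zero (+ n)     = ≡.refl
binom-zero -[1+ j ]  = ≡.refl

binom-pascal : ∀ s k → binom (ℤ.suc s) (suc k) ≡ binom s k ℤ.+ binom s (suc k)
binom-pascal (+ n)         k = ≡.cong +_ (≡.sym (nCk+nC[k+1]≡[n+1]C[k+1] n k))
binom-pascal -[1+ zero ]   k = begin
  + 0                                          ≡⟨ ≡.sym (ℤ.+-inverseʳ (signℤ k (+ 1))) ⟩
  signℤ k (+ 1) ℤ.+ ℤ.- signℤ k (+ 1)          ≡⟨ ≡.cong₂ (λ x y → signℤ k (+ x) ℤ.+ ℤ.- signℤ k (+ y))
                                                           (≡.sym (nCn≡1 k)) (≡.sym (nCn≡1 (suc k))) ⟩
  binom -[1+ 0 ] k ℤ.+ binom -[1+ 0 ] (suc k)  ∎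
  where open ≡.≡-Reasoning
binom-pascal -[1+ suc j ]  k = begin
  ℤ.- v                                        ≡⟨ cancel u v ⟩
  u ℤ.+ ℤ.- (u ℤ.+ v)                          ≡⟨ ≡.cong (λ x → u ℤ.+ ℤ.- x) (signℤ-+ k _ _) ⟨
  u ℤ.+ ℤ.- signℤ k (+ (N C k ℕ.+ N C suc k))  ≡⟨ ≡.cong (λ x → u ℤ.+ ℤ.- signℤ k (+ x))
                                                           (nCk+nC[k+1]≡[n+1]C[k+1] N k) ⟩
  u ℤ.+ w                                      ≡⟨ ≡.cong (λ x → signℤ k (+ (x C k)) ℤ.+ w) (ℕ.+-suc j k) ⟩
  binom -[1+ suc j ] k ℤ.+ binom -[1+ suc j ] (suc k) ∎
  where
  open ≡.≡-Reasoning
  N : ℕ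
  N = j ℕ.+ suc k
  u v w : ℤ
  u = signℤ k (+ (N C k))
  v = signℤ k (+ (N C suc k))
  w = ℤ.- signℤ k (+ (suc N C suc k))
  cancel : ∀ u v → ℤ.- v ≡ u ℤ.+ ℤ.- (u ℤ.+ v)
  cancel = solve-∀

module _ {c ℓ : Level} (F : Field c ℓ) where
  open Field F
  open import Relation.Binary.Reasoning.Setoid setoid
  open import Algebra.Properties.Group +-group using (∙-cancelˡ; ε⁻¹≈ε)
  open import Algebra.Properties.AbelianGroup +-abelianGroup using (⁻¹-∙-comm)
  open import Algebra.Properties.CommutativeSemigroup +-commutativeSemigroup
    using (interchange; x∙yz≈y∙xz)

  natF-+ : ∀ m n → natF F (m ℕ.+ n) ≈ natF F m + natF F n
  natF-+ zero    n = sym (+-identityˡ _)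
  natF-+ (suc m) n = trans (+-congˡ (natF-+ m n)) (sym (+-assoc _ _ _))

  intF-⊖ : ∀ m n → intF F (m ⊖ n) ≈ natF F m - natF F n
  intF-⊖ m       zero    = sym (trans (+-congˡ ε⁻¹≈ε) (+-identityʳ _))
  intF-⊖ zero    (suc n) = sym (+-identityˡ _)
  intF-⊖ (suc m) (suc n) = begin
    intF F (suc m ⊖ suc n)                 ≡⟨ ≡.cong (intF F) (ℤ.[1+m]⊖[1+n]≡m⊖n m n) ⟩
    intF F (m ⊖ n)                         ≈⟨ intF-⊖ m n ⟩
    natF F m - natF F n                    ≈⟨ +-identityˡ _ ⟨
    0# + (natF F m - natF F n)             ≈⟨ +-congʳ (-‿inverseʳ 1#) ⟨
    (1# - 1#) + (natF F m - natF F n)      ≈⟨ interchange _ _ _ _ ⟩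
    natF F (suc m) + (- 1# - natF F n)     ≈⟨ +-congˡ (⁻¹-∙-comm 1# (natF F n)) ⟩
    natF F (suc m) - natF F (suc n)        ∎

  intF-+ : ∀ x y → intF F (x ℤ.+ y) ≈ intF F x + intF F y
  intF-+ (+ m)     (+ n)     = natF-+ m n
  intF-+ (+ m)     -[1+ n ]  = intF-⊖ m (suc n)
  intF-+ -[1+ m ]  (+ n)     = trans (intF-⊖ n (suc m)) (+-comm _ _)
  intF-+ -[1+ m ]  -[1+ n ]  = begin
    - natF F (suc (suc (m ℕ.+ n)))           ≡⟨ ≡.cong (λ x → - natF F (suc x)) (ℕ.+-suc m n) ⟨
    - natF F (suc m ℕ.+ suc n)               ≈⟨ -‿cong (natF-+ (suc m) (suc n)) ⟩
    - (natF F (suc m) + natF F (suc n))      ≈⟨ ⁻¹-∙-comm _ _ ⟨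
    - natF F (suc m) - natF F (suc n)        ∎

  -- [x^i] (1+x)^s; by definition B F s a is the Cauchy product of binomialSeries s with a.
  binomialSeries : ℤ → ℕ → Carrier
  binomialSeries s i = intF F (binom s i)

  binomialSeries-zero : ∀ s → binomialSeries s 0 ≈ 1#
  binomialSeries-zero s = trans (reflexive (≡.cong (intF F) (binom-zero s))) (+-identityʳ 1#)

  binomialSeries-pascal : ∀ s k →
    binomialSeries (ℤ.suc s) (suc k) ≈ binomialSeries s k + binomialSeries s (suc k)
  binomialSeries-pascal s k =
    trans (reflexive (≡.cong (intF F) (binom-pascal s k))) (intF-+ (binom s k) (binom s (suc k)))

  sumTo-cong : ∀ m {f g : ℕ → Carrier} → (∀ i → i ≤ m → f i ≈ g i) → sumTo F f m ≈ sumTo F g m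
  sumTo-cong zero    f≈g = f≈g 0 z≤n
  sumTo-cong (suc m) f≈g =
    +-cong (sumTo-cong m (λ i i≤m → f≈g i (ℕ.m≤n⇒m≤1+n i≤m))) (f≈g (suc m) ℕ.≤-refl)

  sumTo-cong′ : ∀ m {f g : ℕ → Carrier} → (∀ i → f i ≈ g i) → sumTo F f m ≈ sumTo F g m
  sumTo-cong′ m f≈g = sumTo-cong m (λ i _ → f≈g i)

  sumTo-+ : ∀ m (f g : ℕ → Carrier) → sumTo F (λ i → f i + g i) m ≈ sumTo F f m + sumTo F g m
  sumTo-+ zero    f g = refl
  sumTo-+ (suc m) f g = trans (+-congʳ (sumTo-+ m f g)) (interchange _ _ _ _)

  *-distribˡ-sumTo : ∀ m x (f : ℕ → Carrier) → x * sumTo F f m ≈ sumTo F (λ i → x * f i) m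
  *-distribˡ-sumTo zero    x f = refl
  *-distribˡ-sumTo (suc m) x f = trans (distribˡ x _ _) (+-congʳ (*-distribˡ-sumTo m x f))

  *-distribʳ-sumTo : ∀ m x (f : ℕ → Carrier) → sumTo F f m * x ≈ sumTo F (λ i → f i * x) m
  *-distribʳ-sumTo zero    x f = refl
  *-distribʳ-sumTo (suc m) x f = trans (distribʳ x _ _) (+-congʳ (*-distribʳ-sumTo m x f))

  sumTo-zero : ∀ m → sumTo F (λ _ → 0#) m ≈ 0#
  sumTo-zero zero    = refl
  sumTo-zero (suc m) = trans (+-identityʳ _) (sumTo-zero m)

  sumTo-head : ∀ m (f : ℕ → Carrier) → sumTo F f (suc m) ≈ f 0 + sumTo F (λ i → f (suc i)) m
  sumTo-head zero    f = refl
  sumTo-head (suc m) f = trans (+-congʳ (sumTo-head m f)) (+-assoc _ _ _)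

  sumTo-reverse : ∀ m (f : ℕ → Carrier) → sumTo F f m ≈ sumTo F (λ i → f (m ∸ i)) m
  sumTo-reverse zero    f = refl
  sumTo-reverse (suc m) f = begin
    sumTo F f m + f (suc m)                       ≈⟨ +-congʳ (sumTo-reverse m f) ⟩
    sumTo F (λ i → f (m ∸ i)) m + f (suc m)       ≈⟨ +-comm _ _ ⟩
    f (suc m) + sumTo F (λ i → f (m ∸ i)) m       ≈⟨ sumTo-head m (λ i → f (suc m ∸ i)) ⟨
    sumTo F (λ i → f (suc m ∸ i)) (suc m)         ∎

  sumTo-exchange : ∀ m (G : ℕ → ℕ → Carrier) →
    sumTo F (λ i → sumTo F (G i) (m ∸ i)) m ≈ sumTo F (λ p → sumTo F (λ i → G i (p ∸ i)) p) m
  sumTo-exchange zero    G = refl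
  sumTo-exchange (suc m) G = begin
    sumTo F (λ i → sumTo F (G i) (suc m ∸ i)) (suc m)
      ≈⟨ sumTo-head m (λ i → sumTo F (G i) (suc m ∸ i)) ⟩
    sumTo F (G 0) (suc m) + sumTo F (λ i → sumTo F (G (suc i)) (m ∸ i)) m
      ≈⟨ +-cong (sumTo-head m (G 0)) (sumTo-exchange m (λ i → G (suc i))) ⟩
    (G 0 0 + sumTo F (λ p → G 0 (suc p)) m) + sumTo F K m
      ≈⟨ +-assoc _ _ _ ⟩
    G 0 0 + (sumTo F (λ p → G 0 (suc p)) m + sumTo F K m)
      ≈⟨ +-congˡ (sumTo-+ m _ _) ⟨
    G 0 0 + sumTo F (λ p → G 0 (suc p) + K p) m
      ≈⟨ +-congˡ (sumTo-cong′ m (λ p → sumTo-head p (λ i → G i (suc p ∸ i)))) ⟨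
    G 0 0 + sumTo F (λ p → H (suc p)) m
      ≈⟨ sumTo-head m H ⟨
    sumTo F H (suc m) ∎
    where
    K H : ℕ → Carrier
    K p = sumTo F (λ i → G (suc i) (p ∸ i)) p
    H p = sumTo F (λ i → G i (p ∸ i)) p

  infix 4 _≋_
  _≋_ : (ℕ → Carrier) → (ℕ → Carrier) → Set ℓ
  f ≋ g = ∀ i → f i ≈ g i

  ≋-isEquivalence : IsEquivalence _≋_
  ≋-isEquivalence = record
    { refl  = λ i → refl
    ; sym   = λ f≋g i → sym (f≋g i)
    ; trans = λ f≋g g≋h i → trans (f≋g i) (g≋h i)
    }

  cauchy-cong : ∀ {f f′ g g′} → f ≋ f′ → g ≋ g′ → cauchy F f g ≋ cauchy F f′ g′
  cauchy-cong f≋f′ g≋g′ m = sumTo-cong′ m (λ i → *-cong (f≋f′ i) (g≋g′ (m ∸ i)))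

  cauchy-comm : ∀ f g → cauchy F f g ≋ cauchy F g f
  cauchy-comm f g m = trans (sumTo-reverse m _) (sumTo-cong m λ i i≤m →
    trans (*-congˡ (reflexive (≡.cong g (ℕ.m∸[m∸n]≡n i≤m)))) (*-comm _ _))

  cauchy-assoc : ∀ f g h → cauchy F (cauchy F f g) h ≋ cauchy F f (cauchy F g h)
  cauchy-assoc f g h m = sym (begin
    sumTo F (λ i → f i * sumTo F (λ j → g j * h (m ∸ i ∸ j)) (m ∸ i)) m
      ≈⟨ sumTo-cong′ m (λ i → *-distribˡ-sumTo (m ∸ i) (f i) _) ⟩
    sumTo F (λ i → sumTo F (λ j → f i * (g j * h (m ∸ i ∸ j))) (m ∸ i)) m
      ≈⟨ sumTo-exchange m (λ i j → f i * (g j * h (m ∸ i ∸ j))) ⟩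
    sumTo F (λ p → sumTo F (λ i → f i * (g (p ∸ i) * h (m ∸ i ∸ (p ∸ i)))) p) m
      ≈⟨ sumTo-cong′ m (λ p → sumTo-cong p λ i i≤p →
           trans (*-congˡ (*-congˡ (reflexive (≡.cong h (∸-∸-cancel p i i≤p)))))
                 (sym (*-assoc _ _ _))) ⟩
    sumTo F (λ p → sumTo F (λ i → (f i * g (p ∸ i)) * h (m ∸ p)) p) m
      ≈⟨ sumTo-cong′ m (λ p → *-distribʳ-sumTo p (h (m ∸ p)) _) ⟨
    sumTo F (λ p → sumTo F (λ i → f i * g (p ∸ i)) p * h (m ∸ p)) m ∎)
    where
    ∸-∸-cancel : ∀ p i → i ≤ p → m ∸ i ∸ (p ∸ i) ≡ m ∸ p
    ∸-∸-cancel p i i≤p = ≡.trans (ℕ.∸-+-assoc m i (p ∸ i)) (≡.cong (m ∸_) (ℕ.m+[n∸m]≡n i≤p))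

  cauchy-commutativeSemigroup : CommutativeSemigroup c ℓ
  cauchy-commutativeSemigroup = record
    { _≈_ = _≋_
    ; _∙_ = cauchy F
    ; isCommutativeSemigroup = record
      { isSemigroup = record
        { isMagma = record { isEquivalence = ≋-isEquivalence ; ∙-cong = cauchy-cong }
        ; assoc   = cauchy-assoc
        }
      ; comm = cauchy-comm
      }
    }

  open import Algebra.Properties.CommutativeSemigroup cauchy-commutativeSemigroup
    using () renaming (x∙yz≈y∙xz to cauchy-left-comm)

  B-cong : ∀ {s t} → s ≡ t → ∀ g → B F s g ≋ B F t g
  B-cong ≡.refl g i = refl

  B-zero : ∀ g → B F (+ 0) g ≋ g
  B-zero g zero    = trans (*-congʳ (+-identityʳ 1#)) (*-identityˡ _)
  B-zero g (suc m) = begin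
    B F (+ 0) g (suc m)                               ≈⟨ sumTo-head m _ ⟩
    (1# + 0#) * g (suc m) + sumTo F (λ i → 0# * g (m ∸ i)) m
      ≈⟨ +-cong (trans (*-congʳ (+-identityʳ 1#)) (*-identityˡ _))
                (trans (sumTo-cong′ m (λ i → zeroˡ _)) (sumTo-zero m)) ⟩
    g (suc m) + 0#                                    ≈⟨ +-identityʳ _ ⟩
    g (suc m)                                         ∎

  B-head : ∀ s g → B F s g 0 ≈ g 0
  B-head s g = trans (*-congʳ (binomialSeries-zero s)) (*-identityˡ _)

  -- (1+x)^(s+1) g = (1+x)^s g + x (1+x)^s g
  B-pascal : ∀ s g k → B F (ℤ.suc s) g (suc k) ≈ B F s g k + B F s g (suc k)
  B-pascal s g k = begin
    B F (ℤ.suc s) g (suc k)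
      ≈⟨ sumTo-head k _ ⟩
    β (ℤ.suc s) 0 * g (suc k) + sumTo F (λ i → β (ℤ.suc s) (suc i) * g (k ∸ i)) k
      ≈⟨ +-cong (*-congʳ (trans (binomialSeries-zero (ℤ.suc s)) (sym (binomialSeries-zero s))))
                (sumTo-cong′ k (λ i → trans (*-congʳ (binomialSeries-pascal s i)) (distribʳ _ _ _))) ⟩
    β s 0 * g (suc k) + sumTo F (λ i → β s i * g (k ∸ i) + β s (suc i) * g (k ∸ i)) k
      ≈⟨ +-congˡ (sumTo-+ k _ _) ⟩
    β s 0 * g (suc k) + (B F s g k + sumTo F (λ i → β s (suc i) * g (k ∸ i)) k)
      ≈⟨ x∙yz≈y∙xz _ _ _ ⟩
    B F s g k + (β s 0 * g (suc k) + sumTo F (λ i → β s (suc i) * g (k ∸ i)) k)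
      ≈⟨ +-congˡ (sumTo-head k _) ⟨
    B F s g k + B F s g (suc k) ∎
    where
    β : ℤ → ℕ → Carrier
    β = binomialSeries

  PascalRecurrence : (ℤ → ℕ → Carrier) → Set ℓ
  PascalRecurrence X = ∀ s k → X (ℤ.suc s) (suc k) ≈ X s k + X s (suc k)

  -- Rows are propagated upwards by the recurrence and downwards by cancellation.
  pascal-unique : ∀ {X Y} → PascalRecurrence X → PascalRecurrence Y →
    (∀ s → X s 0 ≈ Y s 0) → X (+ 0) ≋ Y (+ 0) → ∀ s → X s ≋ Y s
  pascal-unique {X} {Y} pascalX pascalY column row = ℤ-induction (λ s → X s ≋ Y s) row up down
    where
    up : ∀ s → X s ≋ Y s → X (ℤ.suc s) ≋ Y (ℤ.suc s)
    up s X≋Y zero    = column (ℤ.suc s)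
    up s X≋Y (suc k) = trans (pascalX s k) (trans (+-cong (X≋Y k) (X≋Y (suc k))) (sym (pascalY s k)))

    down : ∀ s → X (ℤ.suc s) ≋ Y (ℤ.suc s) → X s ≋ Y s
    down s X≋Y zero    = column s
    down s X≋Y (suc k) = ∙-cancelˡ (Y s k) _ _ (begin
      Y s k + X s (suc k)   ≈⟨ +-congʳ (down s X≋Y k) ⟨
      X s k + X s (suc k)   ≈⟨ pascalX s k ⟨
      X (ℤ.suc s) (suc k)   ≈⟨ X≋Y (suc k) ⟩
      Y (ℤ.suc s) (suc k)   ≈⟨ pascalY s k ⟩
      Y s k + Y s (suc k)   ∎)

  B-+ : ∀ s t g → B F s (B F t g) ≋ B F (s ℤ.+ t) g
  B-+ s t g = pascal-unique (λ s → B-pascal s (B F t g)) pascalY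
    (λ s → trans (B-head s (B F t g)) (trans (B-head t g) (sym (B-head (s ℤ.+ t) g))))
    (λ i → trans (B-zero (B F t g) i) (B-cong (≡.sym (ℤ.+-identityˡ t)) g i)) s
    where
    pascalY : PascalRecurrence (λ s → B F (s ℤ.+ t) g)
    pascalY s k = trans (B-cong (ℤ.+-assoc (+ 1) s t) g (suc k)) (B-pascal (s ℤ.+ t) g k)

  cauchy-B : ∀ s t a b → cauchy F (B F s a) (B F t b) ≋ B F (s ℤ.+ t) (cauchy F a b)
  cauchy-B s t a b m = begin
    cauchy F (B F s a) (B F t b) m  ≈⟨ cauchy-assoc (binomialSeries s) a (B F t b) m ⟩
    B F s (cauchy F a (B F t b)) m  ≈⟨ cauchy-cong (λ i → refl) (cauchy-left-comm a (binomialSeries t) b) m ⟩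
    B F s (B F t (cauchy F a b)) m  ≈⟨ B-+ s t (cauchy F a b) m ⟩
    B F (s ℤ.+ t) (cauchy F a b) m  ∎

open import Data.Integer using (-_; _-_)

corollary5p8 : ∀ {c ℓ : Level} (F : Field c ℓ) → CharZero F →
    ((a b : ℕ → Field.Carrier F) (m : ℕ) →
      Field._≈_ F (cauchy F a b m) (Field.0# F) →
      (n : ℤ) → Field._≈_ F (cauchy F (B F n a) (B F (- n) b) m) (Field.0# F))
    ×
    ((a : ℕ → Field.Carrier F) (k : ℕ) (n : ℤ) →
      Field._≈_ F (binArray F a k n) (Field.0# F) →
      (l : ℤ) →
      Field._≈_ F
        (sumTo F (λ i → Field._*_ F (intF F (binom l i)) (binArray F a (k ∸ i) (n - l))) k)
        (Field.0# F))
corollary5p8 F _ =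
    (λ a b m a*b≈0 n → begin
      cauchy F (B F n a) (B F (- n) b) m    ≈⟨ cauchy-B F n (- n) a b m ⟩
      B F (n ℤ.+ - n) (cauchy F a b) m      ≈⟨ B-cong F (ℤ.+-inverseʳ n) (cauchy F a b) m ⟩
      B F (+ 0) (cauchy F a b) m            ≈⟨ B-zero F (cauchy F a b) m ⟩
      cauchy F a b m                        ≈⟨ a*b≈0 ⟩
      0#                                    ∎)
  , (λ a k n aₖₙ≈0 l → begin
      B F l (B F (n - l) a) k               ≈⟨ B-+ F l (n - l) a k ⟩
      B F (l ℤ.+ (n - l)) a k               ≈⟨ B-cong F (l+[n-l]≡n l n) a k ⟩
      B F n a k                             ≈⟨ aₖₙ≈0 ⟩
      0#                                    ∎)
  where
  open Field F using (0#; setoid)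
  open import Relation.Binary.Reasoning.Setoid setoid

  l+[n-l]≡n : ∀ l n → l ℤ.+ (n - l) ≡ n
  l+[n-l]≡n = solve-∀
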